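{- For every $n,k,\alpha\in\mathbb{N}_{>0}$ and every $\Pi\subseteq 2^{[n]}$, the pair $M_{n,k,\alpha}(\Pi)=([n],\mathcal{I}_{n,k,\alpha}(\Pi))$ is a matroid.
   Context: $[n]=\{1,\dots,n\}$ and for $S\subseteq[n]$, $\mathrm{sum}(S)=\sum_{i\in S}i$. Define $\mathcal{J}_{n,k}=\{S\subseteq[n]: |S|<k\}$, $\mathcal{K}_{n,k,\alpha}=\{S\subseteq[n]: |S|=k,\ \mathrm{sum}(S)\neq\alpha\}$, $\mathcal{L}_{n,k,\alpha}(\Pi)=\{S\subseteq[n]: |S|=k,\ \mathrm{sum}(S)=\alpha,\ S\in\Pi\}$, and $\mathcal{I}_{n,k,\alpha}(\Pi)=\mathcal{J}_{n,k}\cup\mathcal{K}_{n,k,\alpha}\cup\mathcal{L}_{n,k,\alpha}(\Pi)$. A matroid is a pair $(E,\mathcal{I})$ with $E$ finite, $\emptyset\in\mathcal{I}\subseteq2^E$, $\mathcal{I}$ closed under subsets, and for $A,B\in\mathcal{I}$ with $|A|>|B|$ there is $e\in A\setminus B$ with $B\cup\{e\}\in\mathcal{I}$. -}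

module Defs where

open import Data.Nat using (ℕ; zero; suc; _+_; _<_)
open import Data.Fin using (Fin; toℕ)
open import Data.Fin.Subset using (Subset; _∈_; _∉_; _⊆_; ∣_∣; ⊥; _∪_; ⁅_⁆; inside; outside)
open import Data.Vec using (Vec; []; _∷_)
open import Data.Bool using (Bool; true; false)
open import Data.Product using (∃-syntax; _×_)
open import Data.Sum using (_⊎_)
open import Relation.Binary.PropositionalEquality using (_≡_; _≢_)
open import Level using (Level)

-- The ground set [n] = {1,…,n} is modelled by Fin n, where i : Fin n stands
-- for the natural number toℕ i + 1.  Subsets of [n] are Subset n.

sumAux : ∀ {m} → ℕ → Vec Bool m → ℕ
sumAux k [] = 0
sumAux k (true ∷ s) = suc k + sumAux (suc k) s
sumAux k (false ∷ s) = sumAux (suc k) s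

sumS : ∀ {n} → Subset n → ℕ
sumS S = sumAux 0 S

record IsMatroid {ℓ} (n : ℕ) (I : Subset n → Set ℓ) : Set ℓ where
  field
    empty-indep : I ⊥
    down-closed : ∀ {A B : Subset n} → A ⊆ B → I B → I A
    exchange    : ∀ {A B : Subset n} → I A → I B → ∣ B ∣ < ∣ A ∣ →
                  ∃[ e ] (e ∈ A × e ∉ B × I (B ∪ ⁅ e ⁆))

𝒥 : (n k : ℕ) → Subset n → Set
𝒥 n k S = ∣ S ∣ < k

𝒦 : (n k α : ℕ) → Subset n → Set
𝒦 n k α S = ∣ S ∣ ≡ k × sumS S ≢ α

ℒ : ∀ {ℓ} (n k α : ℕ) → (Subset n → Set ℓ) → Subset n → Set ℓ
ℒ n k α Π S = ∣ S ∣ ≡ k × sumS S ≡ α × Π S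

ℐ : ∀ {ℓ} (n k α : ℕ) → (Subset n → Set ℓ) → Subset n → Set ℓ
ℐ n k α Π S = 𝒥 n k S ⊎ 𝒦 n k α S ⊎ ℒ n k α Π S

{-# OPTIONS --safe #-}
module Submission where

-- Every set of size < k is independent, and an independent set has size at
-- most k, so downward closure only has to look at the sets of size exactly k,
-- which are closed under taking subsets of the same size.  For exchange with
-- ∣ B ∣ < ∣ A ∣ any e ∈ A ∖ B works unless ∣ B ∣ = k − 1.  In that case either
-- A = B ∪ {e}, which is independent, or A ∖ B has a second element f; since
-- sum(B ∪ {e}) and sum(B ∪ {f}) differ, one of them avoids α and lies in 𝒦.

open import Defs
open import Data.Nat using (ℕ; NonZero; suc; _+_; _<_; _≤_; _<?_; _≟_; >-nonZero⁻¹)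
open import Data.Nat.Properties
  using (suc-injective; +-assoc; +-comm; +-suc; +-identityʳ; +-cancelˡ-≡;
         <⇒≤; ≤⇒≯; ≮⇒≥; ≤-antisym; ≤-trans; ≤-reflexive)
open import Data.Fin using (toℕ; zero; suc)
open import Data.Fin.Properties using (toℕ-injective; any?)
open import Data.Fin.Subset using (Subset; _∈_; _∉_; _⊆_; ∣_∣; ⊥; _∪_; ⁅_⁆)
open import Data.Fin.Subset.Properties
  using (_∈?_; ∣⊥∣≡0; p⊆q⇒∣p∣≤∣q∣; p⊂q⇒∣p∣<∣q∣; ⊆-antisym; ∪-identityʳ;
         drop-not-there; p⊆p∪q; q⊆p∪q; x∈⁅x⁆)
open import Data.Vec.Base using (_∷_; here)
open import Data.Bool using (true; false)
open import Data.Product using (∃-syntax; _×_; _,_)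
open import Data.Sum using (_⊎_; inj₁; inj₂)
open import Function using (_∘_)
open import Level using (Level)
open import Relation.Nullary using (yes; no; ¬?; contradiction)
open import Relation.Nullary.Decidable using (_×-dec_; decidable-stable)
open import Relation.Binary.PropositionalEquality
  using (_≡_; _≢_; refl; sym; trans; cong; subst; module ≡-Reasoning)

⊆⊎∃∈∉ : ∀ {n} (p q : Subset n) → p ⊆ q ⊎ ∃[ x ] (x ∈ p × x ∉ q)
⊆⊎∃∈∉ p q with any? (λ x → x ∈? p ×-dec ¬? (x ∈? q))
... | yes witness = inj₂ witness
... | no none     = inj₁ λ {x} x∈p →
  decidable-stable (x ∈? q) (λ x∉q → none (x , x∈p , x∉q))

p⊆q∧∣q∣≤∣p∣⇒p≡q : ∀ {n} {p q : Subset n} → p ⊆ q → ∣ q ∣ ≤ ∣ p ∣ → p ≡ q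
p⊆q∧∣q∣≤∣p∣⇒p≡q {p = p} {q} p⊆q ∣q∣≤∣p∣ with ⊆⊎∃∈∉ q p
... | inj₁ q⊆p             = ⊆-antisym p⊆q q⊆p
... | inj₂ (x , x∈q , x∉p) =
  contradiction (p⊂q⇒∣p∣<∣q∣ (p⊆q , x , x∈q , x∉p)) (≤⇒≯ ∣q∣≤∣p∣)

∣q∣<∣p∣⇒∃∈∉ : ∀ {n} {p q : Subset n} → ∣ q ∣ < ∣ p ∣ → ∃[ x ] (x ∈ p × x ∉ q)
∣q∣<∣p∣⇒∃∈∉ {p = p} {q} ∣q∣<∣p∣ with ⊆⊎∃∈∉ p q
... | inj₁ p⊆q   = contradiction ∣q∣<∣p∣ (≤⇒≯ (p⊆q⇒∣p∣≤∣q∣ p⊆q))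
... | inj₂ found = found

∣p∪⁅x⁆∣≡1+∣p∣ : ∀ {n} {p : Subset n} {x} → x ∉ p → ∣ p ∪ ⁅ x ⁆ ∣ ≡ suc ∣ p ∣
∣p∪⁅x⁆∣≡1+∣p∣ {p = true  ∷ p} {zero}  x∉p = contradiction here x∉p
∣p∪⁅x⁆∣≡1+∣p∣ {p = false ∷ p} {zero}  _   = cong (suc ∘ ∣_∣) (∪-identityʳ p)
∣p∪⁅x⁆∣≡1+∣p∣ {p = true  ∷ p} {suc x} x∉p = cong suc (∣p∪⁅x⁆∣≡1+∣p∣ (drop-not-there x∉p))
∣p∪⁅x⁆∣≡1+∣p∣ {p = false ∷ p} {suc x} x∉p = ∣p∪⁅x⁆∣≡1+∣p∣ (drop-not-there x∉p)

sumAux-∪⁅⁆ : ∀ {n} k {p : Subset n} {x} → x ∉ p →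
             sumAux k (p ∪ ⁅ x ⁆) ≡ sumAux k p + suc (k + toℕ x)
sumAux-∪⁅⁆ k {true  ∷ p} {zero}  x∉p = contradiction here x∉p
sumAux-∪⁅⁆ k {false ∷ p} {zero}  _
  rewrite ∪-identityʳ p | +-identityʳ k = +-comm (suc k) (sumAux (suc k) p)
sumAux-∪⁅⁆ k {true  ∷ p} {suc x} x∉p = begin
  suc k + sumAux (suc k) (p ∪ ⁅ x ⁆)           ≡⟨ cong (suc k +_) (sumAux-∪⁅⁆ (suc k) (drop-not-there x∉p)) ⟩
  suc k + (sumAux (suc k) p + suc (suc k + toℕ x)) ≡⟨ sym (+-assoc (suc k) _ _) ⟩
  suc k + sumAux (suc k) p + suc (suc k + toℕ x)   ≡⟨ cong (λ m → suc k + sumAux (suc k) p + suc m) (sym (+-suc k (toℕ x))) ⟩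
  suc k + sumAux (suc k) p + suc (k + suc (toℕ x)) ∎
  where open ≡-Reasoning
sumAux-∪⁅⁆ k {false ∷ p} {suc x} x∉p = begin
  sumAux (suc k) (p ∪ ⁅ x ⁆)           ≡⟨ sumAux-∪⁅⁆ (suc k) (drop-not-there x∉p) ⟩
  sumAux (suc k) p + suc (suc k + toℕ x) ≡⟨ cong (λ m → sumAux (suc k) p + suc m) (sym (+-suc k (toℕ x))) ⟩
  sumAux (suc k) p + suc (k + suc (toℕ x)) ∎
  where open ≡-Reasoning

sumS-∪⁅⁆-injective : ∀ {n} {p : Subset n} {x y} → x ∉ p → y ∉ p →
                     sumS (p ∪ ⁅ x ⁆) ≡ sumS (p ∪ ⁅ y ⁆) → x ≡ y
sumS-∪⁅⁆-injective {p = p} x∉p y∉p eq = toℕ-injective (suc-injective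
  (+-cancelˡ-≡ (sumS p) _ _
    (trans (sym (sumAux-∪⁅⁆ 0 x∉p)) (trans eq (sumAux-∪⁅⁆ 0 y∉p)))))

module _ {ℓ : Level} {n k α : ℕ} {Π : Subset n → Set ℓ} where

  private
    I : Subset n → Set ℓ
    I = ℐ n k α Π

  ℐ⇒∣∣≤k : ∀ {S} → I S → ∣ S ∣ ≤ k
  ℐ⇒∣∣≤k (inj₁ ∣S∣<k)                = <⇒≤ ∣S∣<k
  ℐ⇒∣∣≤k (inj₂ (inj₁ (∣S∣≡k , _)))   = ≤-reflexive ∣S∣≡k
  ℐ⇒∣∣≤k (inj₂ (inj₂ (∣S∣≡k , _)))   = ≤-reflexive ∣S∣≡k

  ℐ-down-closed : ∀ {A B} → A ⊆ B → I B → I A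
  ℐ-down-closed {A} {B} A⊆B IB with ∣ A ∣ <? k
  ... | yes ∣A∣<k = inj₁ ∣A∣<k
  ... | no  ∣A∣≮k = subst I (sym A≡B) IB
    where
      A≡B : A ≡ B
      A≡B = p⊆q∧∣q∣≤∣p∣⇒p≡q A⊆B (≤-trans (ℐ⇒∣∣≤k IB) (≮⇒≥ ∣A∣≮k))

  ℐ-exchange-full : ∀ {A B e} → I A → suc ∣ B ∣ ≤ ∣ A ∣ → suc ∣ B ∣ ≡ k →
                    e ∈ A → e ∉ B → ∃[ x ] (x ∈ A × x ∉ B × I (B ∪ ⁅ x ⁆))
  ℐ-exchange-full {A} {B} {e} IA ∣B∣<∣A∣ 1+∣B∣≡k e∈A e∉B
    with ⊆⊎∃∈∉ A (B ∪ ⁅ e ⁆)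
  ... | inj₁ A⊆B+e = e , e∈A , e∉B , subst I A≡B+e IA
    where
      A≡B+e : A ≡ B ∪ ⁅ e ⁆
      A≡B+e = p⊆q∧∣q∣≤∣p∣⇒p≡q A⊆B+e (subst (_≤ ∣ A ∣) (sym (∣p∪⁅x⁆∣≡1+∣p∣ e∉B)) ∣B∣<∣A∣)
  ... | inj₂ (f , f∈A , f∉B+e) with sumS (B ∪ ⁅ e ⁆) ≟ α
  ...   | no  sum≢α = e , e∈A , e∉B , inj₂ (inj₁ (trans (∣p∪⁅x⁆∣≡1+∣p∣ e∉B) 1+∣B∣≡k , sum≢α))
  ...   | yes sum≡α = f , f∈A , f∉B , inj₂ (inj₁ (trans (∣p∪⁅x⁆∣≡1+∣p∣ f∉B) 1+∣B∣≡k , sum≢α))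
    where
      f∉B : f ∉ B
      f∉B = f∉B+e ∘ p⊆p∪q ⁅ e ⁆
      f≢e : f ≢ e
      f≢e refl = f∉B+e (q⊆p∪q B ⁅ e ⁆ (x∈⁅x⁆ e))
      sum≢α : sumS (B ∪ ⁅ f ⁆) ≢ α
      sum≢α eq = f≢e (sumS-∪⁅⁆-injective f∉B e∉B (trans eq (sym sum≡α)))

  ℐ-exchange : ∀ {A B} → I A → I B → ∣ B ∣ < ∣ A ∣ →
               ∃[ x ] (x ∈ A × x ∉ B × I (B ∪ ⁅ x ⁆))
  ℐ-exchange {A} {B} IA _ ∣B∣<∣A∣ with ∣q∣<∣p∣⇒∃∈∉ ∣B∣<∣A∣ | suc ∣ B ∣ <? k
  ... | e , e∈A , e∉B | yes 1+∣B∣<k =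
    e , e∈A , e∉B , inj₁ (subst (_< k) (sym (∣p∪⁅x⁆∣≡1+∣p∣ e∉B)) 1+∣B∣<k)
  ... | e , e∈A , e∉B | no  1+∣B∣≮k = ℐ-exchange-full IA ∣B∣<∣A∣ 1+∣B∣≡k e∈A e∉B
    where
      1+∣B∣≡k : suc ∣ B ∣ ≡ k
      1+∣B∣≡k = ≤-antisym (≤-trans ∣B∣<∣A∣ (ℐ⇒∣∣≤k IA)) (≮⇒≥ 1+∣B∣≮k)

  ℐ-isMatroid : 0 < k → IsMatroid n I
  ℐ-isMatroid 0<k = record
    { empty-indep = inj₁ (subst (_< k) (sym (∣⊥∣≡0 n)) 0<k)
    ; down-closed = ℐ-down-closed
    ; exchange    = ℐ-exchange
    }

lemma2p2 : (n k α : ℕ) → NonZero n → NonZero k → NonZero α →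
           (Π : Subset n → Set) → IsMatroid n (ℐ n k α Π)
lemma2p2 n k α _ k≢0 _ Π = ℐ-isMatroid (>-nonZero⁻¹ k {{k≢0}})
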